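{- If $G$ is a graph of order $n$, then $\gamma_a(G\circ K_1)=\gamma(G\circ K_1)+1=n+1$.
   Context: All graphs are simple. The corona $G\circ K_1$ is obtained from $G$ by adding, for each vertex $v\in V(G)$, a new vertex $v'$ and the pendant edge $vv'$. A dominating set of a graph $H=(V,E)$ is a set $D\subseteq V$ such that every vertex not in $D$ is adjacent to some vertex of $D$; $\gamma(H)$ is the minimum cardinality of a dominating set. A dominating set $D$ is accurate if no $|D|$-element subset of $V\setminus D$ is a dominating set of $H$; $\gamma_a(H)$ is the minimum cardinality of an accurate dominating set. -}

module Defs where

open import Data.Nat using (ℕ; _+_; _≤_)
open import Data.Bool using (Bool; true; false)
open import Data.Fin using (Fin; splitAt)
open import Data.Fin.Properties using (_≟_)
open import Data.Fin.Subset using (Subset; _∈_; _∉_; _⊆_; ∁; ∣_∣)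
open import Data.Sum using (_⊎_; inj₁; inj₂)
open import Data.Product using (Σ; ∃; _×_; _,_)
open import Relation.Binary.PropositionalEquality using (_≡_; refl)
open import Relation.Nullary using (¬_)
open import Relation.Nullary.Decidable using (⌊_⌋)

record Graph (n : ℕ) : Set where
  field
    adj     : Fin n → Fin n → Bool
    sym     : ∀ u v → adj u v ≡ adj v u
    irrefl  : ∀ v → adj v v ≡ false
open Graph public

-- Corona G ∘ K₁ on vertex set Fin (n + n):
-- via splitAt n, inj₁ v is the original vertex v, inj₂ v is the new vertex v'.
coronaAdj : ∀ {n} → Graph n → Fin (n + n) → Fin (n + n) → Bool
coronaAdj {n} G x y with splitAt n x | splitAt n y
... | inj₁ u | inj₁ v = adj G u v
... | inj₁ u | inj₂ v = ⌊ u ≟ v ⌋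
... | inj₂ u | inj₁ v = ⌊ v ≟ u ⌋
... | inj₂ u | inj₂ v = false

corona : ∀ {n} → Graph n → Graph (n + n)
corona {n} G = record { adj = coronaAdj G ; sym = symP ; irrefl = irreflP }
  where
  symP : ∀ x y → coronaAdj G x y ≡ coronaAdj G y x
  symP x y with splitAt n x | splitAt n y
  ... | inj₁ u | inj₁ v = Graph.sym G u v
  ... | inj₁ u | inj₂ v = refl
  ... | inj₂ u | inj₁ v = refl
  ... | inj₂ u | inj₂ v = refl
  irreflP : ∀ x → coronaAdj G x x ≡ false
  irreflP x with splitAt n x
  ... | inj₁ u = Graph.irrefl G u
  ... | inj₂ u = refl

Dominating : ∀ {m} → Graph m → Subset m → Set
Dominating {m} H D = ∀ v → v ∉ D → ∃ λ u → u ∈ D × adj H u v ≡ true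

AccurateDominating : ∀ {m} → Graph m → Subset m → Set
AccurateDominating H D =
  Dominating H D × (∀ D′ → D′ ⊆ ∁ D → ∣ D′ ∣ ≡ ∣ D ∣ → ¬ Dominating H D′)

IsMinCard : ∀ {m} → (Subset m → Set) → ℕ → Set
IsMinCard {m} P k = (∃ λ D → P D × ∣ D ∣ ≡ k) × (∀ D → P D → k ≤ ∣ D ∣)

IsDominationNumber : ∀ {m} → Graph m → ℕ → Set
IsDominationNumber H = IsMinCard (Dominating H)

IsAccurateDominationNumber : ∀ {m} → Graph m → ℕ → Set
IsAccurateDominationNumber H = IsMinCard (AccurateDominating H)

-- A set dominates the corona G ∘ K₁ exactly when it meets every pendant edge vv′,
-- since a pendant vertex v′ has v as its only neighbour. So γ = n, and a dominating
-- set of size n meets each pendant edge exactly once; its complement then also meets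
-- every pendant edge and has size n, so no dominating set of size n is accurate.
-- On the other hand V(G) together with one pendant vertex has n + 1 elements while
-- its complement has only n − 1, so it is accurate for trivial reasons.
module Submission where

open import Defs hiding (sym)
open import Data.Nat using (ℕ; suc; _+_; _∸_; _≤_; _<_; z≤n; s≤s)
open import Data.Nat.Properties
  using (+-suc; +-comm; +-identityʳ; +-monoˡ-≤; +-monoʳ-≤; m≤m+n; m∸n≤m; n<1+n;
         [m+n]∸[m+o]≡n∸o; m+n∸n≡m; ≤-trans; ≤-<-trans; <-irrefl; m≤n⇒m<n∨m≡n; module ≤-Reasoning)
open import Data.Bool using (true; false)
open import Data.Fin using (Fin; zero; splitAt; _↑ˡ_; _↑ʳ_)
open import Data.Fin.Properties using (_≟_; splitAt-↑ˡ; splitAt-↑ʳ; splitAt⁻¹-↑ˡ; splitAt⁻¹-↑ʳ)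
open import Data.Fin.Subset
  using (Subset; inside; outside; _∈_; _⊆_; ∁; ∣_∣; ⊤; ⊥; ⁅_⁆; _∪_; _∩_)
open import Data.Fin.Subset.Properties
  using (_∈?_; ∈⊤; ⊆-refl; x∉p⇒x∈∁p; x∈p∪q⁺; x∈p∩q⁺; p⊆q⇒∣p∣≤∣q∣;
         ∣⊤∣≡n; ∣⊥∣≡0; ∣⁅x⁆∣≡1; ∣∁p∣≡n∸∣p∣; x∈p⇒∣p-x∣<∣p∣)
open import Data.Vec using ([]; _∷_; _++_)
import Data.Vec as Vec
open import Data.Vec.Properties using (lookup-++ˡ; lookup-++ʳ; []=⇒lookup; lookup⇒[]=)
open import Data.Sum using (_⊎_; inj₁; inj₂)
open import Data.Product using (_×_; _,_)
open import Relation.Binary.PropositionalEquality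
  using (_≡_; refl; sym; trans; cong; subst; module ≡-Reasoning)
open import Relation.Nullary using (¬_; yes; no; contradiction)

∣p++q∣≡∣p∣+∣q∣ : ∀ {m k} (p : Subset m) (q : Subset k) → ∣ p ++ q ∣ ≡ ∣ p ∣ + ∣ q ∣
∣p++q∣≡∣p∣+∣q∣ []            q = refl
∣p++q∣≡∣p∣+∣q∣ (inside  ∷ p) q = cong suc (∣p++q∣≡∣p∣+∣q∣ p q)
∣p++q∣≡∣p∣+∣q∣ (outside ∷ p) q = ∣p++q∣≡∣p∣+∣q∣ p q

∣p∣+∣q∣≡∣p∪q∣+∣p∩q∣ : ∀ {n} (p q : Subset n) → ∣ p ∣ + ∣ q ∣ ≡ ∣ p ∪ q ∣ + ∣ p ∩ q ∣
∣p∣+∣q∣≡∣p∪q∣+∣p∩q∣ [] [] = refl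
∣p∣+∣q∣≡∣p∪q∣+∣p∩q∣ (inside ∷ p) (inside ∷ q) = cong suc (begin
  ∣ p ∣ + suc ∣ q ∣           ≡⟨ +-suc ∣ p ∣ ∣ q ∣ ⟩
  suc (∣ p ∣ + ∣ q ∣)         ≡⟨ cong suc (∣p∣+∣q∣≡∣p∪q∣+∣p∩q∣ p q) ⟩
  suc (∣ p ∪ q ∣ + ∣ p ∩ q ∣) ≡⟨ sym (+-suc ∣ p ∪ q ∣ ∣ p ∩ q ∣) ⟩
  ∣ p ∪ q ∣ + suc ∣ p ∩ q ∣   ∎)
  where open ≡-Reasoning
∣p∣+∣q∣≡∣p∪q∣+∣p∩q∣ (inside ∷ p) (outside ∷ q) = cong suc (∣p∣+∣q∣≡∣p∪q∣+∣p∩q∣ p q)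
∣p∣+∣q∣≡∣p∪q∣+∣p∩q∣ (outside ∷ p) (inside ∷ q) =
  trans (+-suc ∣ p ∣ ∣ q ∣) (cong suc (∣p∣+∣q∣≡∣p∪q∣+∣p∩q∣ p q))
∣p∣+∣q∣≡∣p∪q∣+∣p∩q∣ (outside ∷ p) (outside ∷ q) = ∣p∣+∣q∣≡∣p∪q∣+∣p∩q∣ p q

⊤⊆p∪q⇒n+∣p∩q∣≤∣p∣+∣q∣ : ∀ {n} (p q : Subset n) → ⊤ ⊆ p ∪ q → n + ∣ p ∩ q ∣ ≤ ∣ p ∣ + ∣ q ∣
⊤⊆p∪q⇒n+∣p∩q∣≤∣p∣+∣q∣ {n} p q ⊤⊆p∪q = begin
  n + ∣ p ∩ q ∣         ≡⟨ cong (_+ ∣ p ∩ q ∣) (sym (∣⊤∣≡n n)) ⟩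
  ∣ ⊤ {n} ∣ + ∣ p ∩ q ∣ ≤⟨ +-monoˡ-≤ ∣ p ∩ q ∣ (p⊆q⇒∣p∣≤∣q∣ ⊤⊆p∪q) ⟩
  ∣ p ∪ q ∣ + ∣ p ∩ q ∣ ≡⟨ sym (∣p∣+∣q∣≡∣p∪q∣+∣p∩q∣ p q) ⟩
  ∣ p ∣ + ∣ q ∣         ∎
  where open ≤-Reasoning

module _ {m k} (p : Subset m) (q : Subset k) where

  ↑ˡ∈p++q⁻ : ∀ i → i ↑ˡ k ∈ p ++ q → i ∈ p
  ↑ˡ∈p++q⁻ i i∈ = lookup⇒[]= i p (trans (sym (lookup-++ˡ p q i)) ([]=⇒lookup i∈))

  ↑ˡ∈p++q⁺ : ∀ i → i ∈ p → i ↑ˡ k ∈ p ++ q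
  ↑ˡ∈p++q⁺ i i∈ = lookup⇒[]= (i ↑ˡ k) (p ++ q) (trans (lookup-++ˡ p q i) ([]=⇒lookup i∈))

  ↑ʳ∈p++q⁻ : ∀ i → m ↑ʳ i ∈ p ++ q → i ∈ q
  ↑ʳ∈p++q⁻ i i∈ = lookup⇒[]= i q (trans (sym (lookup-++ʳ p q i)) ([]=⇒lookup i∈))

module _ {m} {H : Graph m} {D : Subset m} where

  complement-dominating⇒¬accurate :
    Dominating H (∁ D) → ∣ ∁ D ∣ ≡ ∣ D ∣ → ¬ AccurateDominating H D
  complement-dominating⇒¬accurate ∁D-dom ∣∁D∣≡∣D∣ (_ , accurate) =
    accurate (∁ D) ⊆-refl ∣∁D∣≡∣D∣ ∁D-dom

  dominating∧∣∁D∣<∣D∣⇒accurate :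
    Dominating H D → ∣ ∁ D ∣ < ∣ D ∣ → AccurateDominating H D
  dominating∧∣∁D∣<∣D∣⇒accurate dom ∣∁D∣<∣D∣ =
    dom , λ D′ D′⊆∁D ∣D′∣≡∣D∣ _ →
      <-irrefl ∣D′∣≡∣D∣ (≤-<-trans (p⊆q⇒∣p∣≤∣q∣ D′⊆∁D) ∣∁D∣<∣D∣)

data CoronaVertex (n : ℕ) : Fin (n + n) → Set where
  original : ∀ v → CoronaVertex n (v ↑ˡ n)
  pendant  : ∀ v → CoronaVertex n (n ↑ʳ v)

coronaVertex : ∀ {n} x → CoronaVertex n x
coronaVertex {n} x with splitAt n x in eq
... | inj₁ v = subst (CoronaVertex n) (splitAt⁻¹-↑ˡ eq) (original v)
... | inj₂ v = subst (CoronaVertex n) (splitAt⁻¹-↑ʳ eq) (pendant v)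

module PendantCovers (n : ℕ) where

  PendantCover : Subset (n + n) → Set
  PendantCover D = ∀ v → v ↑ˡ n ∈ D ⊎ n ↑ʳ v ∈ D

  ∣⊤++q∣≡n+∣q∣ : (q : Subset n) → ∣ ⊤ {n} ++ q ∣ ≡ n + ∣ q ∣
  ∣⊤++q∣≡n+∣q∣ q = trans (∣p++q∣≡∣p∣+∣q∣ (⊤ {n}) q) (cong (_+ ∣ q ∣) (∣⊤∣≡n n))

  pendantCover-⊤++ : (q : Subset n) → PendantCover (⊤ ++ q)
  pendantCover-⊤++ q v = inj₁ (↑ˡ∈p++q⁺ (⊤ {n}) q v ∈⊤)

  pendantCover⇒n+∣p∩q∣≤∣p++q∣ : (p q : Subset n) → PendantCover (p ++ q) →
                                n + ∣ p ∩ q ∣ ≤ ∣ p ++ q ∣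
  pendantCover⇒n+∣p∩q∣≤∣p++q∣ p q cover = begin
    n + ∣ p ∩ q ∣ ≤⟨ ⊤⊆p∪q⇒n+∣p∩q∣≤∣p∣+∣q∣ p q ⊤⊆p∪q ⟩
    ∣ p ∣ + ∣ q ∣ ≡⟨ sym (∣p++q∣≡∣p∣+∣q∣ p q) ⟩
    ∣ p ++ q ∣    ∎
    where
    open ≤-Reasoning
    ⊤⊆p∪q : ⊤ ⊆ p ∪ q
    ⊤⊆p∪q {v} _ with cover v
    ... | inj₁ v∈D  = x∈p∪q⁺ (inj₁ (↑ˡ∈p++q⁻ p q v v∈D))
    ... | inj₂ v′∈D = x∈p∪q⁺ (inj₂ (↑ʳ∈p++q⁻ p q v v′∈D))

  pendantCover⇒n≤∣D∣ : (D : Subset (n + n)) → PendantCover D → n ≤ ∣ D ∣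
  pendantCover⇒n≤∣D∣ D cover with Vec.splitAt n D
  ... | p , q , refl = ≤-trans (m≤m+n n ∣ p ∩ q ∣) (pendantCover⇒n+∣p∩q∣≤∣p++q∣ p q cover)

  pendantCover⇒n<∣D∣ : (D : Subset (n + n)) → PendantCover D →
                       ∀ v → v ↑ˡ n ∈ D → n ↑ʳ v ∈ D → n < ∣ D ∣
  pendantCover⇒n<∣D∣ D cover v v∈D v′∈D with Vec.splitAt n D
  ... | p , q , refl = begin
    suc n         ≡⟨ +-comm 1 n ⟩
    n + 1         ≤⟨ +-monoʳ-≤ n (≤-trans (s≤s z≤n) (x∈p⇒∣p-x∣<∣p∣ v∈p∩q)) ⟩
    n + ∣ p ∩ q ∣ ≤⟨ pendantCover⇒n+∣p∩q∣≤∣p++q∣ p q cover ⟩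
    ∣ p ++ q ∣    ∎
    where
    open ≤-Reasoning
    v∈p∩q : v ∈ p ∩ q
    v∈p∩q = x∈p∩q⁺ (↑ˡ∈p++q⁻ p q v v∈D , ↑ʳ∈p++q⁻ p q v v′∈D)

  -- A cover of size n contains exactly one end of each pendant edge.
  pendantCover-∁ : (D : Subset (n + n)) → ∣ D ∣ ≡ n → PendantCover D → PendantCover (∁ D)
  pendantCover-∁ D ∣D∣≡n cover v with v ↑ˡ n ∈? D | n ↑ʳ v ∈? D
  ... | no v∉D   | _         = inj₁ (x∉p⇒x∈∁p v∉D)
  ... | yes _    | no v′∉D   = inj₂ (x∉p⇒x∈∁p v′∉D)
  ... | yes v∈D  | yes v′∈D  =
    contradiction (pendantCover⇒n<∣D∣ D cover v v∈D v′∈D) (<-irrefl (sym ∣D∣≡n))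

  ∣D∣≡n⇒∣∁D∣≡n : (D : Subset (n + n)) → ∣ D ∣ ≡ n → ∣ ∁ D ∣ ≡ n
  ∣D∣≡n⇒∣∁D∣≡n D ∣D∣≡n = trans (∣∁p∣≡n∸∣p∣ D) (trans (cong ((n + n) ∸_) ∣D∣≡n) (m+n∸n≡m n n))

module _ {n} (G : Graph n) where

  open PendantCovers n

  corona-original~pendant⇒≡ : ∀ v w → adj (corona G) (v ↑ˡ n) (n ↑ʳ w) ≡ true → v ≡ w
  corona-original~pendant⇒≡ v w rewrite splitAt-↑ˡ n v n | splitAt-↑ʳ n n w with v ≟ w
  ... | yes v≡w = λ _ → v≡w
  ... | no  _   = λ ()

  corona-original~own-pendant : ∀ v → adj (corona G) (v ↑ˡ n) (n ↑ʳ v) ≡ true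
  corona-original~own-pendant v rewrite splitAt-↑ˡ n v n | splitAt-↑ʳ n n v with v ≟ v
  ... | yes _   = refl
  ... | no  v≢v = contradiction refl v≢v

  corona-pendant≁pendant : ∀ v w → adj (corona G) (n ↑ʳ v) (n ↑ʳ w) ≡ false
  corona-pendant≁pendant v w rewrite splitAt-↑ʳ n n v | splitAt-↑ʳ n n w = refl

  dominating⇒pendantCover : (D : Subset (n + n)) → Dominating (corona G) D → PendantCover D
  dominating⇒pendantCover D dom v with n ↑ʳ v ∈? D
  ... | yes v′∈D = inj₂ v′∈D
  ... | no  v′∉D with dom (n ↑ʳ v) v′∉D
  ... | u , u∈D , u~v′ with coronaVertex {n} u
  ...   | original w = inj₁ (subst (λ w → w ↑ˡ n ∈ D) (corona-original~pendant⇒≡ w v u~v′) u∈D)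
  ...   | pendant  w = contradiction (trans (sym u~v′) (corona-pendant≁pendant w v)) λ ()

  pendantCover⇒dominating : (D : Subset (n + n)) → PendantCover D → Dominating (corona G) D
  pendantCover⇒dominating D cover x x∉D with coronaVertex {n} x
  ... | original v with cover v
  ...   | inj₁ v∈D  = contradiction v∈D x∉D
  ...   | inj₂ v′∈D = n ↑ʳ v , v′∈D ,
                      trans (Graph.sym (corona G) (n ↑ʳ v) (v ↑ˡ n)) (corona-original~own-pendant v)
  pendantCover⇒dominating D cover x x∉D | pendant v with cover v
  ...   | inj₁ v∈D  = v ↑ˡ n , v∈D , corona-original~own-pendant v
  ...   | inj₂ v′∈D = contradiction v′∈D x∉D

  accurateDominating⇒n<∣D∣ : (D : Subset (n + n)) → AccurateDominating (corona G) D → n < ∣ D ∣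
  accurateDominating⇒n<∣D∣ D accurate@(dom , _)
    with cover ← dominating⇒pendantCover D dom
    with m≤n⇒m<n∨m≡n (pendantCover⇒n≤∣D∣ D cover)
  ... | inj₁ n<∣D∣ = n<∣D∣
  ... | inj₂ n≡∣D∣ = contradiction accurate
    (complement-dominating⇒¬accurate {H = corona G}
      (pendantCover⇒dominating (∁ D) (pendantCover-∁ D (sym n≡∣D∣) cover))
      (trans (∣D∣≡n⇒∣∁D∣≡n D (sym n≡∣D∣)) n≡∣D∣))

  corona-domination : IsDominationNumber (corona G) n
  corona-domination =
      (V , pendantCover⇒dominating V (pendantCover-⊤++ ⊥) , ∣V∣≡n)
    , λ D dom → pendantCover⇒n≤∣D∣ D (dominating⇒pendantCover D dom)
    where
    V : Subset (n + n)
    V = ⊤ {n} ++ ⊥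
    ∣V∣≡n : ∣ V ∣ ≡ n
    ∣V∣≡n = trans (∣⊤++q∣≡n+∣q∣ ⊥) (trans (cong (n +_) (∣⊥∣≡0 n)) (+-identityʳ n))

  corona-accurate-domination : Fin n → IsAccurateDominationNumber (corona G) (n + 1)
  corona-accurate-domination v =
      (D , dominating∧∣∁D∣<∣D∣⇒accurate {H = corona G} D-dominating ∣∁D∣<∣D∣ , ∣D∣≡n+1)
    , λ D′ accurate → subst (_≤ ∣ D′ ∣) (+-comm 1 n) (accurateDominating⇒n<∣D∣ D′ accurate)
    where
    D : Subset (n + n)
    D = ⊤ ++ ⁅ v ⁆
    D-dominating : Dominating (corona G) D
    D-dominating = pendantCover⇒dominating D (pendantCover-⊤++ ⁅ v ⁆)
    ∣D∣≡n+1 : ∣ D ∣ ≡ n + 1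
    ∣D∣≡n+1 = trans (∣⊤++q∣≡n+∣q∣ ⁅ v ⁆) (cong (n +_) (∣⁅x⁆∣≡1 v))
    ∣∁D∣<∣D∣ : ∣ ∁ D ∣ < ∣ D ∣
    ∣∁D∣<∣D∣ = begin-strict
      ∣ ∁ D ∣           ≡⟨ ∣∁p∣≡n∸∣p∣ D ⟩
      (n + n) ∸ ∣ D ∣   ≡⟨ cong ((n + n) ∸_) ∣D∣≡n+1 ⟩
      (n + n) ∸ (n + 1) ≡⟨ [m+n]∸[m+o]≡n∸o n n 1 ⟩
      n ∸ 1             ≤⟨ m∸n≤m n 1 ⟩
      n                 <⟨ n<1+n n ⟩
      suc n             ≡⟨ +-comm 1 n ⟩
      n + 1             ≡⟨ sym ∣D∣≡n+1 ⟩
      ∣ D ∣             ∎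
      where open ≤-Reasoning

theorem2p6 : (n : ℕ) → 1 ≤ n → (G : Graph n) →
    IsDominationNumber (corona G) n × IsAccurateDominationNumber (corona G) (n + 1)
theorem2p6 (suc k) _ G = corona-domination G , corona-accurate-domination G zero
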